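{- Let $l\ge 1$ be an integer. Every digraph of circumference at most $l$ has directed tree-width at most $3l+1$.
   Context: The circumference of a digraph is the number of vertices of a longest directed cycle (2-cycles count); circumference at most $l$ means no directed cycle has more than $l$ vertices. Directed tree-width (Johnson, Robertson, Seymour, Thomas): for a digraph $D$ and $X\subseteq V(D)$, a set $Z\subseteq V(D)\setminus X$ is $X$-guarded if there is no directed walk in $D-X$ whose first and last vertices lie in $Z$ and which uses a vertex outside $Z\cup X$. An arboreal decomposition of $D$ is a triple $(R,(X_e)_{e\in A(R)},(W_r)_{r\in V(R)})$ where $R$ is an out-arborescence, the sets $W_r$ are nonempty and partition $V(D)$, and for every arc $e=(r_1,r_2)$ of $R$, the set $\bigcup\{W_r: r_2\le r\}$ (union over $r_2$ and its descendants in $R$) is $X_e$-guarded. Its width is the maximum over $r\in V(R)$ of $|W_r\cup\bigcup_{e\sim r}X_e|-1$, where $e\sim r$ means $e$ is incident with $r$. The directed tree-width of $D$ is the minimum width of an arboreal decomposition of $D$. -}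

module Defs where

open import Data.Nat using (ℕ; zero; suc; _+_; _*_; _≤_; _<_)
open import Data.Fin using (Fin; zero; suc; toℕ; fromℕ; inject₁)
open import Data.Fin.Subset using (Subset; _∈_; _∉_; ∣_∣; _∪_; ⋃)
open import Data.Fin.Properties using (_≟_)
open import Data.Bool using (Bool; true; false; _∨_)
open import Data.List using (List; filter)
open import Data.List.Base using (allFin)
open import Data.Vec using (tabulate)
open import Data.Product using (Σ; ∃; _×_; _,_)
open import Data.Sum using (_⊎_)
open import Relation.Nullary using (¬_; does)
open import Relation.Nullary.Decidable using (_⊎-dec_)
open import Relation.Binary.PropositionalEquality using (_≡_)
open import Function.Definitions using (Injective)

-- Digraphs: finite nonempty vertex set Fin (suc n'), a decidable
-- (Boolean) arc relation, no loops.  Parallel arcs are irrelevant here.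

record Digraph : Set where
  field
    size    : ℕ                       -- number of vertices minus one
    arc     : Fin (suc size) → Fin (suc size) → Bool
    loopless : ∀ v → arc v v ≡ false

open Digraph public

V : Digraph → Set
V D = Fin (suc (size D))

Arc : (D : Digraph) → V D → V D → Set
Arc D u v = arc D u v ≡ true

record DirectedCycle (D : Digraph) (k : ℕ) : Set where
  field
    vtx      : Fin (suc k) → V D        -- vertices c 0 … c k  (so k+1 vertices)
    distinct : Injective _≡_ _≡_ vtx
    step     : ∀ (i : Fin k) → Arc D (vtx (inject₁ i)) (vtx (suc i))
    close    : Arc D (vtx (fromℕ k)) (vtx zero)

CircumferenceAtMost : Digraph → ℕ → Set
CircumferenceAtMost D l = ∀ k → DirectedCycle D k → suc k ≤ l

record DirectedWalk (D : Digraph) (k : ℕ) : Set where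
  field
    vtx  : Fin (suc k) → V D
    step : ∀ (i : Fin k) → Arc D (vtx (inject₁ i)) (vtx (suc i))

Guarded : (D : Digraph) → Subset (suc (size D)) → (V D → Set) → Set
Guarded D X Z =
  (∀ v → Z v → v ∉ X) ×
  (∀ k (w : DirectedWalk D k) →
     let open DirectedWalk w in
     (∀ i → vtx i ∉ X) → Z (vtx zero) → Z (vtx (fromℕ k)) →
     ¬ (Σ (Fin (suc k)) λ j → ¬ Z (vtx j) × vtx j ∉ X))

-- Out-arborescences, encoded with nodes Fin (suc m), root zero, and for
-- each non-root node suc i a parent  par i  with toℕ (par i) ≤ toℕ i
-- (i.e. the parent has smaller index; every out-arborescence admits such
-- a labelling).  The arcs of R are e_i = (par i , suc i), i : Fin m.

record OutArborescence : Set where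
  field
    m      : ℕ
    par    : Fin m → Fin (suc m)
    par<   : ∀ i → toℕ (par i) ≤ toℕ i

open OutArborescence public

Node : OutArborescence → Set
Node R = Fin (suc (m R))

ArcR : OutArborescence → Set
ArcR R = Fin (m R)

-- Below R a r : r is a (weak) descendant of a, i.e. a ≤ r in R
data Below (R : OutArborescence) (a : Node R) : Node R → Set where
  here  : Below R a a
  child : ∀ i → Below R a (par R i) → Below R a (suc i)

headR : (R : OutArborescence) → ArcR R → Node R
headR R i = suc i

tailR : (R : OutArborescence) → ArcR R → Node R
tailR R i = par R i

incident : (R : OutArborescence) → Node R → ArcR R → Bool
incident R r i = does (headR R i ≟ r) ∨ does (tailR R i ≟ r)

record ArborealDecomposition (D : Digraph) : Set where
  field
    R        : OutArborescence
    X        : ArcR R → Subset (suc (size D))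
    -- the partition (W_r) is given by the node  bagOf v  containing v
    bagOf    : V D → Node R
    nonempty : ∀ (r : Node R) → ∃ λ v → bagOf v ≡ r
    guarded  : ∀ (i : ArcR R) →
                 Guarded D (X i) (λ v → Below R (headR R i) (bagOf v))

  W : Node R → Subset (suc (size D))
  W r = tabulate (λ v → does (bagOf v ≟ r))

  bag : Node R → Subset (suc (size D))
  bag r = W r ∪ ⋃ (Data.List.map X (filter (λ i → incident R r i Data.Bool.≟ true) (allFin (m R))))

WidthAtMost : {D : Digraph} → ArborealDecomposition D → ℕ → Set
WidthAtMost d k = ∀ r → ∣ ArborealDecomposition.bag d r ∣ ≤ suc k

DirectedTreeWidthAtMost : Digraph → ℕ → Set
DirectedTreeWidthAtMost D k = Σ (ArborealDecomposition D) λ d → WidthAtMost d k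

module Submission where

-- Run a depth-first search, numbering the vertices in preorder; each restart of the search is
-- recorded as an extra tree arc from vertex 0, so the search forest becomes a single tree rooted
-- at 0.  This tree is the decomposition tree, every bag holds one vertex, and the arc into a node
-- c is guarded by the l nearest proper ancestors of c, so bags have at most l + 1 vertices.
-- A DFS has no arc from the subtree of c to a later non-descendant, and none from an earlier
-- non-ancestor into the subtree or past it.  Hence a walk that leaves the subtree of c and comes
-- back first reaches a proper ancestor a of c, which lies more than l tree steps above c.  The
-- exit arc, the part of the walk up to a (shortened to a path), and the tree path from a down to
-- the exit vertex form a cycle through more than l vertices, unless that tree path crosses a
-- restart; but then nothing numbered after the restart is reachable from a.

open import Defs
open import Data.Bool using (Bool; true; false)
open import Data.Bool.Properties using (¬-not)
import Data.Bool.Properties as Bool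
open import Data.Empty using (⊥; ⊥-elim)
open import Data.Fin using (Fin; zero; suc; toℕ; inject₁; fromℕ; fromℕ<)
import Data.Fin.Properties as FinP
open import Data.Fin.Subset using (Subset; _∪_; ∣_∣; ⁅_⁆; ⋃)
  renaming (⊥ to ⊥ₛ; _∈_ to _∈ₛ_; _∉_ to _∉ₛ_; _⊆_ to _⊆ₛ_)
open import Data.Fin.Subset.Properties
  using (∣⊥∣≡0; ∣⁅x⁆∣≡1; x∈p∪q⁺; x∈p∪q⁻; x∈⁅x⁆; ∉⊥; p⊆q⇒∣p∣≤∣q∣)
open import Data.List using (List; []; _∷_; length)
import Data.List as List
open import Data.List.Membership.Propositional using (_∈_; _∉_)
open import Data.List.Membership.Propositional.Properties using (∈-filter⁻)
open import Data.List.Relation.Binary.Subset.Propositional using (_⊆_)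
open import Data.List.Relation.Unary.All using (All; []; _∷_)
import Data.List.Relation.Unary.All as All
open import Data.List.Relation.Unary.All.Properties using (¬Any⇒All¬)
import Data.List.Relation.Unary.All.Properties as Allₚ
open import Data.List.Relation.Unary.AllPairs using ([]; _∷_)
open import Data.List.Relation.Unary.Any using (Any; here; there)
import Data.List.Relation.Unary.Any.Properties as Anyₚ
open import Data.List.Relation.Unary.Unique.Propositional using (Unique)
open import Data.List.Relation.Unary.Unique.Propositional.Properties using (Unique[x∷xs]⇒x∉xs)
open import Data.Nat using (ℕ; zero; suc; pred; _+_; _*_; _∸_; _≤_; _<_; z≤n; s≤s; _<?_; >-nonZero)
open import Data.Nat.Properties
open import Data.List.Membership.DecPropositional _≟_ using () renaming (_∈?_ to _∈ℕ?_)
open import Data.Product using (Σ; ∃; _×_; _,_; proj₁; proj₂)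
open import Data.Sum using (_⊎_; inj₁; inj₂)
open import Data.Vec using ([]; _∷_; tabulate)
open import Data.Vec.Properties using ([]=⇒lookup; lookup⇒[]=; lookup∘tabulate)
open import Function using (id; _∘_)
open import Relation.Binary.Construct.Closure.ReflexiveTransitive using (Star; ε; _◅_; _◅◅_)
open import Relation.Binary.Definitions using (DecidableEquality)
open import Relation.Binary.PropositionalEquality
open import Relation.Nullary using (¬_; Dec; yes; no; does)
open import Relation.Nullary.Decidable using (_×-dec_; dec-true)

data BelowN (p : ℕ → ℕ) (a : ℕ) : ℕ → Set where
  here  : BelowN p a a
  child : ∀ b → BelowN p a (p b) → BelowN p a (suc b)

BelowN-transfer : ∀ {p q : ℕ → ℕ} {a c} → (∀ b → p b ≤ b) →
  (∀ b → suc b ≤ c → p b ≡ q b) → BelowN p a c → BelowN q a c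
BelowN-transfer p≤ agree here = here
BelowN-transfer {q = q} {a} p≤ agree (child b a≼pb) =
  child b (subst (BelowN q a) (agree b ≤-refl)
    (BelowN-transfer p≤ (λ b' b'<pb → agree b' (≤-trans b'<pb (m≤n⇒m≤1+n (p≤ b)))) a≼pb))

module Tree (p : ℕ → ℕ) (p≤ : ∀ b → p b ≤ b) where

  _≼_ : ℕ → ℕ → Set
  _≼_ = BelowN p

  ≼⇒≤ : ∀ {a c} → a ≼ c → a ≤ c
  ≼⇒≤ here = ≤-refl
  ≼⇒≤ (child b a≼pb) = m≤n⇒m≤1+n (≤-trans (≼⇒≤ a≼pb) (p≤ b))

  ≼-trans : ∀ {a b c} → a ≼ b → b ≼ c → a ≼ c
  ≼-trans a≼b here = a≼b
  ≼-trans a≼b (child c b≼pc) = child c (≼-trans a≼b b≼pc)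

  0≼ : ∀ b → 0 ≼ b
  0≼ b = go b b ≤-refl
    where
      go : ∀ n b → b ≤ n → 0 ≼ b
      go n zero _ = here
      go (suc n) (suc b) (s≤s b≤n) = child b (go n (p b) (≤-trans (p≤ b) b≤n))

  ≼0⇒≡0 : ∀ {a} → a ≼ 0 → a ≡ 0
  ≼0⇒≡0 here = refl

  ≼suc-inv : ∀ {a b} → a ≼ suc b → a ≡ suc b ⊎ a ≼ p b
  ≼suc-inv here = inj₁ refl
  ≼suc-inv (child _ a≼pb) = inj₂ a≼pb

  ≼-comparable : ∀ {a b c} → a ≼ c → b ≼ c → a ≼ b ⊎ b ≼ a
  ≼-comparable here b≼c = inj₂ b≼c
  ≼-comparable a≼c@(child _ _) here = inj₁ a≼c
  ≼-comparable (child c a≼pc) (child .c b≼pc) = ≼-comparable a≼pc b≼pc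

  _≼?_ : ∀ a b → Dec (a ≼ b)
  a ≼? b = go b a b ≤-refl
    where
      go : ∀ n a b → b ≤ n → Dec (a ≼ b)
      go n a b b≤n with a ≟ b
      ... | yes refl = yes here
      go n a zero b≤n | no a≢b = no λ { here → a≢b refl }
      go (suc n) a (suc b) (s≤s b≤n) | no a≢b with go n a (p b) (≤-trans (p≤ b) b≤n)
      ... | yes a≼pb = yes (child b a≼pb)
      ... | no a⋠pb = no λ { here → a≢b refl ; (child .b a≼pb) → a⋠pb a≼pb }

  parent : ℕ → ℕ
  parent zero = zero
  parent (suc b) = p b

  ancestor : ℕ → ℕ → ℕ
  ancestor zero b = b
  ancestor (suc j) b = ancestor j (parent b)

  distance : ∀ {a b} → a ≼ b → ℕ
  distance here = 0
  distance (child b a≼pb) = suc (distance a≼pb)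

  ancestor-distance : ∀ {a b} (a≼b : a ≼ b) → ancestor (distance a≼b) b ≡ a
  ancestor-distance here = refl
  ancestor-distance (child b a≼pb) = ancestor-distance a≼pb

  distance-trans : ∀ {a b c} (a≼b : a ≼ b) (b≼c : b ≼ c) →
    distance (≼-trans a≼b b≼c) ≡ distance b≼c + distance a≼b
  distance-trans a≼b here = refl
  distance-trans a≼b (child c b≼pc) = cong suc (distance-trans a≼b b≼pc)

  ancestor-≤ : ∀ j b → ancestor j b ≤ b
  ancestor-≤ zero b = ≤-refl
  ancestor-≤ (suc j) zero = ancestor-≤ j zero
  ancestor-≤ (suc j) (suc b) = m≤n⇒m≤1+n (≤-trans (ancestor-≤ j (p b)) (p≤ b))

  proper-ancestor-< : ∀ j b → ancestor (suc j) (suc b) < suc b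
  proper-ancestor-< j b = s≤s (≤-trans (ancestor-≤ j (p b)) (p≤ b))

update : {A B : Set} → DecidableEquality A → (A → B) → A → B → A → B
update _≟_ f a b x with x ≟ a
... | yes _ = b
... | no _ = f x

module _ {A B : Set} (_≟_ : DecidableEquality A) (f : A → B) (a : A) (b : B) where

  update-same : update _≟_ f a b a ≡ b
  update-same with a ≟ a
  ... | yes _ = refl
  ... | no a≢a = ⊥-elim (a≢a refl)

  update-other : ∀ x → x ≢ a → update _≟_ f a b x ≡ f x
  update-other x x≢a with x ≟ a
  ... | yes x≡a = ⊥-elim (x≢a x≡a)
  ... | no _ = refl

-- The DFS stack, top first: a tree path down from a root, i.e. from 0 or from a restart below 0.
Depth≤1 : (ℕ → ℕ) → ℕ → Set
Depth≤1 p r = r ≡ 0 ⊎ Σ ℕ λ b → r ≡ suc b × p b ≡ 0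

data StackPath (p : ℕ → ℕ) (count : ℕ) : List ℕ → Set where
  empty  : StackPath p count []
  bottom : ∀ r → r < count → Depth≤1 p r → StackPath p count (r ∷ [])
  push   : ∀ b h rest → suc b < count → p b ≡ h → StackPath p count (h ∷ rest) →
           StackPath p count (suc b ∷ h ∷ rest)

module _ {p : ℕ → ℕ} {count : ℕ} where

  StackPath-top< : ∀ {g rest} → StackPath p count (g ∷ rest) → g < count
  StackPath-top< (bottom r r<count _) = r<count
  StackPath-top< (push b h rest sb<count _ _) = sb<count

  StackPath-pop : ∀ {g rest} → StackPath p count (g ∷ rest) → StackPath p count rest
  StackPath-pop (bottom r _ _) = empty
  StackPath-pop (push b h rest _ _ path) = path

  StackPath-ancestor : ∀ {g rest} → StackPath p count (g ∷ rest) → ∀ s → s ∈ (g ∷ rest) → BelowN p s g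
  StackPath-ancestor (bottom r _ _) s (here refl) = here
  StackPath-ancestor (push b h rest _ _ _) s (here refl) = here
  StackPath-ancestor (push b h rest _ pb≡h path) s (there s∈) =
    child b (subst (BelowN p s) (sym pb≡h) (StackPath-ancestor path s s∈))

  StackPath-ancestor⁻ : ∀ {g rest} → StackPath p count (g ∷ rest) → ∀ a → BelowN p a g →
                        a ∈ (g ∷ rest) ⊎ a ≡ 0
  StackPath-ancestor⁻ (bottom r _ _) a here = inj₁ (here refl)
  StackPath-ancestor⁻ (bottom _ _ (inj₁ ())) a (child b _)
  StackPath-ancestor⁻ (bottom _ _ (inj₂ (_ , refl , pb≡0))) a (child b a≼pb)
    with subst (BelowN p a) pb≡0 a≼pb
  ... | here = inj₂ refl
  StackPath-ancestor⁻ (push b h rest _ _ _) a here = inj₁ (here refl)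
  StackPath-ancestor⁻ (push b h rest _ pb≡h path) a (child .b a≼pb)
    with StackPath-ancestor⁻ path a (subst (BelowN p a) pb≡h a≼pb)
  ... | inj₁ a∈ = inj₁ (there a∈)
  ... | inj₂ a≡0 = inj₂ a≡0

StackPath-transfer : ∀ {p q count count' stack} → (∀ b → suc b < count → p b ≡ q b) → count ≤ count' →
                     StackPath p count stack → StackPath q count' stack
StackPath-transfer agree count≤ empty = empty
StackPath-transfer agree count≤ (bottom r r< (inj₁ r≡0)) = bottom r (<-≤-trans r< count≤) (inj₁ r≡0)
StackPath-transfer agree count≤ (bottom r r< (inj₂ (b , refl , pb≡0))) =
  bottom r (<-≤-trans r< count≤) (inj₂ (b , refl , trans (sym (agree b r<)) pb≡0))
StackPath-transfer agree count≤ (push b h rest sb< pb≡h path) =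
  push b h rest (<-≤-trans sb< count≤) (trans (sym (agree b sb<)) pb≡h) (StackPath-transfer agree count≤ path)

module DFS (D : Digraph) where

  -- Visited vertices are numbered 0, 1, … in preorder; vertexAt and index are mutually inverse
  -- on them.  A restart of the search at a new root suc b is recorded as a tree arc from 0
  -- (parentOf b ≡ 0) whose head starts a new prefix-closed block.
  record State : Set where
    constructor mkState
    field
      count    : ℕ
      vertexAt : ℕ → V D
      index    : V D → ℕ
      visited  : V D → Bool
      parentOf : ℕ → ℕ
      stack    : List ℕ

  module _ (s : State) where
    open State s

    PrefixClosed : ℕ → Set
    PrefixClosed b =
      ∀ y z → Arc D y z → visited y ≡ true → index y ≤ b → visited z ≡ true × index z ≤ b

    TreeArc : ℕ → Set
    TreeArc b = Arc D (vertexAt (parentOf b)) (vertexAt (suc b)) ⊎ (parentOf b ≡ 0 × PrefixClosed b)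

    record Invariant : Set where
      field
        parentOf≤      : ∀ b → parentOf b ≤ b
        index<         : ∀ y → visited y ≡ true → index y < count
        vertexAt-index : ∀ y → visited y ≡ true → vertexAt (index y) ≡ y
        visited-vertexAt : ∀ i → i < count → visited (vertexAt i) ≡ true
        index-vertexAt : ∀ i → i < count → index (vertexAt i) ≡ i
        treeArc        : ∀ b → suc b < count → TreeArc b
        forward-below  : ∀ y z → Arc D y z → visited y ≡ true → visited z ≡ true → index y < index z →
                           BelowN parentOf (index y) (index z)
        subtree-interval : ∀ a b c → BelowN parentOf a c → a ≤ b → b ≤ c → c < count →
                             BelowN parentOf a b
        finished-closed : ∀ y → visited y ≡ true → index y ∉ stack →
                            ∀ z → Arc D y z → visited z ≡ true
        stackPath      : StackPath parentOf count stack
        stack-below    : ∀ g → g ∈ stack → ∀ i → g ≤ i → i < count → BelowN parentOf g i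

  -- z becomes node count, with parent x (stored at parentOf (pred count)).
  extend : State → V D → ℕ → List ℕ → State
  extend s z x stack' = mkState (suc count) (update _≟_ vertexAt count z) (update FinP._≟_ index z count)
                          (update FinP._≟_ visited z true) (update _≟_ parentOf (pred count) x) stack'
    where open State s

  module Extend (s : State) (I : Invariant s) (z : V D) (z-new : State.visited s z ≡ false)
                (x : ℕ) (x≤ : x ≤ pred (State.count s)) (stack' : List ℕ) where
    open State s
    open Invariant I
    s' : State
    s' = extend s z x stack'
    open State s' public using ()
      renaming (vertexAt to vertexAt'; index to index'; visited to visited'; parentOf to parentOf')

    parentOf'≤ : ∀ b → parentOf' b ≤ b
    parentOf'≤ b = by-cases (b ≟ pred count)
      where
        by-cases : Dec (b ≡ pred count) → parentOf' b ≤ b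
        by-cases (yes refl) = subst (_≤ pred count) (sym (update-same _≟_ parentOf (pred count) x)) x≤
        by-cases (no b≢) = subst (_≤ b) (sym (update-other _≟_ parentOf (pred count) x b b≢)) (parentOf≤ b)

    parentOf-agree : ∀ c → c < count → ∀ b → suc b ≤ c → parentOf b ≡ parentOf' b
    parentOf-agree c c<count b sb≤c =
      sym (update-other _≟_ parentOf (pred count) x b
             (<⇒≢ (suc[m]≤n⇒m≤pred[n] (≤-<-trans sb≤c c<count))))

    below-old⇒new : ∀ {a c} → c < count → BelowN parentOf a c → BelowN parentOf' a c
    below-old⇒new {c = c} c<count = BelowN-transfer parentOf≤ (parentOf-agree c c<count)

    below-new⇒old : ∀ {a c} → c < count → BelowN parentOf' a c → BelowN parentOf a c
    below-new⇒old {c = c} c<count =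
      BelowN-transfer parentOf'≤ (λ b sb≤c → sym (parentOf-agree c c<count b sb≤c))

    visited'-z : visited' z ≡ true
    visited'-z = update-same FinP._≟_ visited z true

    index'-z : index' z ≡ count
    index'-z = update-same FinP._≟_ index z count

    vertexAt'-count : vertexAt' count ≡ z
    vertexAt'-count = update-same _≟_ vertexAt count z

    old≢z : ∀ y → visited y ≡ true → y ≢ z
    old≢z y y-visited refl with trans (sym y-visited) z-new
    ... | ()

    visited'-old : ∀ y → visited y ≡ true → visited' y ≡ true
    visited'-old y y-visited = trans (update-other FinP._≟_ visited z true y (old≢z y y-visited)) y-visited

    index'-old : ∀ y → visited y ≡ true → index' y ≡ index y
    index'-old y y-visited = update-other FinP._≟_ index z count y (old≢z y y-visited)

    vertexAt'-old : ∀ i → i < count → vertexAt' i ≡ vertexAt i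
    vertexAt'-old i i<count = update-other _≟_ vertexAt count z i (<⇒≢ i<count)

    visited'-cases : ∀ y → visited' y ≡ true → y ≡ z ⊎ visited y ≡ true
    visited'-cases y y-visited' = by-cases (y FinP.≟ z)
      where
        by-cases : Dec (y ≡ z) → y ≡ z ⊎ visited y ≡ true
        by-cases (yes y≡z) = inj₁ y≡z
        by-cases (no y≢z) = inj₂ (trans (sym (update-other FinP._≟_ visited z true y y≢z)) y-visited')

    index<' : ∀ y → visited' y ≡ true → index' y < suc count
    index<' y y-visited' with visited'-cases y y-visited'
    ... | inj₁ refl = subst (_< suc count) (sym index'-z) ≤-refl
    ... | inj₂ y-visited = subst (_< suc count) (sym (index'-old y y-visited)) (m≤n⇒m≤1+n (index< y y-visited))

    vertexAt-index' : ∀ y → visited' y ≡ true → vertexAt' (index' y) ≡ y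
    vertexAt-index' y y-visited' with visited'-cases y y-visited'
    ... | inj₁ refl = trans (cong vertexAt' index'-z) vertexAt'-count
    ... | inj₂ y-visited = begin
      vertexAt' (index' y)  ≡⟨ cong vertexAt' (index'-old y y-visited) ⟩
      vertexAt' (index y)   ≡⟨ vertexAt'-old (index y) (index< y y-visited) ⟩
      vertexAt (index y)    ≡⟨ vertexAt-index y y-visited ⟩
      y                     ∎
      where open ≡-Reasoning

    visited-vertexAt' : ∀ i → i < suc count → visited' (vertexAt' i) ≡ true
    visited-vertexAt' i i<sc with m<1+n⇒m<n∨m≡n i<sc
    ... | inj₂ refl = trans (cong visited' vertexAt'-count) visited'-z
    ... | inj₁ i<count = trans (cong visited' (vertexAt'-old i i<count))
                           (visited'-old (vertexAt i) (visited-vertexAt i i<count))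

    index-vertexAt' : ∀ i → i < suc count → index' (vertexAt' i) ≡ i
    index-vertexAt' i i<sc with m<1+n⇒m<n∨m≡n i<sc
    ... | inj₂ refl = trans (cong index' vertexAt'-count) index'-z
    ... | inj₁ i<count = begin
      index' (vertexAt' i)  ≡⟨ cong index' (vertexAt'-old i i<count) ⟩
      index' (vertexAt i)   ≡⟨ index'-old (vertexAt i) (visited-vertexAt i i<count) ⟩
      index (vertexAt i)    ≡⟨ index-vertexAt i i<count ⟩
      i                     ∎
      where open ≡-Reasoning

    treeArc-old : ∀ b → suc b < count → TreeArc s' b
    treeArc-old b sb<count with treeArc b sb<count
    ... | inj₁ arc = inj₁ (subst₂ (Arc D) (sym parent-same) (sym (vertexAt'-old (suc b) sb<count)) arc)
      where
        parent-same : vertexAt' (parentOf' b) ≡ vertexAt (parentOf b)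
        parent-same = trans (cong vertexAt' (sym (parentOf-agree (suc b) sb<count b ≤-refl)))
                            (vertexAt'-old (parentOf b) (≤-<-trans (parentOf≤ b) (<-trans (n<1+n b) sb<count)))
    ... | inj₂ (pb≡0 , closed) = inj₂ (trans (sym (parentOf-agree (suc b) sb<count b ≤-refl)) pb≡0 , closed')
      where
        closed' : PrefixClosed s' b
        closed' y w arc y-visited' iy≤b with visited'-cases y y-visited'
        ... | inj₁ refl = ⊥-elim (<⇒≱ (<-trans (n<1+n b) sb<count) (subst (_≤ b) index'-z iy≤b))
        ... | inj₂ y-visited with closed y w arc y-visited (subst (_≤ b) (index'-old y y-visited) iy≤b)
        ... | (w-visited , iw≤b) = visited'-old w w-visited , subst (_≤ b) (sym (index'-old w w-visited)) iw≤b

    -- The clauses of the invariant that depend only on how z attaches to the tree.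
    module Preserved (arc-to-z    : ∀ y → visited y ≡ true → Arc D y z → BelowN parentOf' (index y) count)
                     (interval-z  : ∀ a b → BelowN parentOf' a count → a ≤ b → b ≤ count →
                                      BelowN parentOf' a b)
                     (count∈stack' : count ∈ stack')
                     (stack⊆stack' : ∀ g → g ∈ stack → g ∈ stack') where

      forward-below' : ∀ y w → Arc D y w → visited' y ≡ true → visited' w ≡ true → index' y < index' w →
                         BelowN parentOf' (index' y) (index' w)
      forward-below' y w arc y-visited' w-visited' iy<iw with visited'-cases y y-visited' | visited'-cases w w-visited'
      ... | inj₁ refl | inj₁ refl = ⊥-elim (<-irrefl refl iy<iw)
      ... | inj₁ refl | inj₂ w-visited =
        ⊥-elim (<⇒≱ iy<iw
          (subst₂ _≤_ (sym (index'-old w w-visited)) (sym index'-z) (<⇒≤ (index< w w-visited))))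
      ... | inj₂ y-visited | inj₁ refl =
        subst₂ (BelowN parentOf') (sym (index'-old y y-visited)) (sym index'-z) (arc-to-z y y-visited arc)
      ... | inj₂ y-visited | inj₂ w-visited =
        subst₂ (BelowN parentOf') (sym (index'-old y y-visited)) (sym (index'-old w w-visited))
          (below-old⇒new (index< w w-visited) (forward-below y w arc y-visited w-visited
             (subst₂ _<_ (index'-old y y-visited) (index'-old w w-visited) iy<iw)))

      subtree-interval' : ∀ a b c → BelowN parentOf' a c → a ≤ b → b ≤ c → c < suc count →
                          BelowN parentOf' a b
      subtree-interval' a b c a≼c a≤b b≤c c<sc with m<1+n⇒m<n∨m≡n c<sc
      ... | inj₂ refl = interval-z a b a≼c a≤b b≤c
      ... | inj₁ c<count =
        below-old⇒new (≤-<-trans b≤c c<count)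
          (subtree-interval a b c (below-new⇒old c<count a≼c) a≤b b≤c c<count)

      finished-closed' : ∀ y → visited' y ≡ true → index' y ∉ stack' →
                         ∀ w → Arc D y w → visited' w ≡ true
      finished-closed' y y-visited' iy∉ w arc with visited'-cases y y-visited'
      ... | inj₁ refl = ⊥-elim (iy∉ (subst (_∈ stack') (sym index'-z) count∈stack'))
      ... | inj₂ y-visited = visited'-old w (finished-closed y y-visited
              (λ iy∈ → iy∉ (subst (_∈ stack') (sym (index'-old y y-visited)) (stack⊆stack' (index y) iy∈)))
              w arc)

  module Push (s : State) (I : Invariant s) (g : ℕ) (rest : List ℕ) (stack≡ : State.stack s ≡ g ∷ rest)
              (z : V D) (z-new : State.visited s z ≡ false) (arc : Arc D (State.vertexAt s g) z) where
    open State s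
    open Invariant I

    path : StackPath parentOf count (g ∷ rest)
    path = subst (StackPath parentOf count) stack≡ stackPath

    g<count : g < count
    g<count = StackPath-top< path

    open Extend s I z z-new g (<⇒≤pred g<count) (count ∷ stack)

    suc-pred-count : suc (pred count) ≡ count
    suc-pred-count = suc-pred count {{>-nonZero (≤-<-trans z≤n g<count)}}

    parent-of-new : parentOf' (pred count) ≡ g
    parent-of-new = update-same _≟_ parentOf (pred count) g

    below-g⇒below-new : ∀ {a} → BelowN parentOf' a g → BelowN parentOf' a count
    below-g⇒below-new {a} a≼g =
      subst (BelowN parentOf' a) suc-pred-count
        (child (pred count) (subst (BelowN parentOf' a) (sym parent-of-new) a≼g))

    arc-to-z : ∀ y → visited y ≡ true → Arc D y z → BelowN parentOf' (index y) count
    arc-to-z y y-visited y→z with index y ∈ℕ? stack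
    ... | yes iy∈ =
      below-g⇒below-new (below-old⇒new g<count (StackPath-ancestor path (index y) (subst (_ ∈_) stack≡ iy∈)))
    ... | no iy∉ with trans (sym (finished-closed y y-visited iy∉ z y→z)) z-new
    ... | ()

    module T = Tree parentOf' parentOf'≤

    interval-z : ∀ a b → BelowN parentOf' a count → a ≤ b → b ≤ count → BelowN parentOf' a b
    interval-z a b a≼count a≤b b≤count
      with T.≼suc-inv (subst (BelowN parentOf' a) (sym suc-pred-count) a≼count)
    ... | inj₁ a≡ = at-count (trans a≡ suc-pred-count)
      where
        at-count : a ≡ count → BelowN parentOf' a b
        at-count refl = subst (BelowN parentOf' count) (≤-antisym a≤b b≤count) here
    ... | inj₂ a≼g'
      with StackPath-ancestor⁻ path a (below-new⇒old g<count (subst (BelowN parentOf' a) parent-of-new a≼g'))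
    ... | inj₂ refl = T.0≼ b
    ... | inj₁ a∈ with m≤n⇒m<n∨m≡n b≤count
    ...   | inj₂ refl = a≼count
    ...   | inj₁ b<count = below-old⇒new b<count (stack-below a (subst (_ ∈_) (sym stack≡) a∈) b a≤b b<count)

    open Preserved arc-to-z interval-z (here refl) (λ _ → there)

    treeArc' : ∀ b → suc b < suc count → TreeArc s' b
    treeArc' b sb<sc with m<1+n⇒m<n∨m≡n sb<sc
    ... | inj₁ sb<count = treeArc-old b sb<count
    ... | inj₂ refl = inj₁ (subst₂ (Arc D) (sym parent-is-g) (sym vertexAt'-count) arc)
      where
        parent-is-g : vertexAt' (parentOf' b) ≡ vertexAt g
        parent-is-g = trans (cong vertexAt' parent-of-new) (vertexAt'-old g g<count)

    stackPath' : StackPath parentOf' (suc count) (count ∷ stack)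
    stackPath' = subst (λ c → StackPath parentOf' (suc count) (c ∷ stack)) suc-pred-count
                   (subst (λ st → StackPath parentOf' (suc count) (suc (pred count) ∷ st)) (sym stack≡)
                     (push (pred count) g rest (subst (_< suc count) (sym suc-pred-count) ≤-refl) parent-of-new
                       (StackPath-transfer (λ b sb<count → parentOf-agree (suc b) sb<count b ≤-refl)
                         (n≤1+n count) path)))

    stack-below' : ∀ h → h ∈ (count ∷ stack) → ∀ i → h ≤ i → i < suc count → BelowN parentOf' h i
    stack-below' h (here refl) i h≤i i<sc = subst (BelowN parentOf' h) (≤-antisym h≤i (≤-pred i<sc)) here
    stack-below' h (there h∈) i h≤i i<sc with m<1+n⇒m<n∨m≡n i<sc
    ... | inj₂ refl =
      below-g⇒below-new (below-old⇒new g<count (StackPath-ancestor path h (subst (_ ∈_) stack≡ h∈)))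
    ... | inj₁ i<count = below-old⇒new i<count (stack-below h h∈ i h≤i i<count)

    invariant : Invariant s'
    invariant = record
      { parentOf≤ = parentOf'≤ ; index< = index<' ; vertexAt-index = vertexAt-index'
      ; visited-vertexAt = visited-vertexAt' ; index-vertexAt = index-vertexAt' ; treeArc = treeArc'
      ; forward-below = forward-below' ; subtree-interval = subtree-interval'
      ; finished-closed = finished-closed' ; stackPath = stackPath' ; stack-below = stack-below' }

  -- With an empty stack every visited vertex is finished, so the visited prefix is closed and
  -- the unvisited vertex z becomes a new root, hung below 0.
  module Restart (s : State) (I : Invariant s) (stack≡[] : State.stack s ≡ [])
                 (z : V D) (z-new : State.visited s z ≡ false) where
    open State s
    open Invariant I
    open Extend s I z z-new 0 z≤n (count ∷ [])

    ∉[] : ∀ {g : ℕ} → g ∉ []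
    ∉[] ()

    all-finished : ∀ y → visited y ≡ true → ∀ w → Arc D y w → visited w ≡ true
    all-finished y y-visited = finished-closed y y-visited (λ iy∈ → ∉[] (subst (_ ∈_) stack≡[] iy∈))

    arc-to-z : ∀ y → visited y ≡ true → Arc D y z → BelowN parentOf' (index y) count
    arc-to-z y y-visited y→z with trans (sym (all-finished y y-visited z y→z)) z-new
    ... | ()

    count-cases : count ≡ 0 ⊎ suc (pred count) ≡ count
    count-cases with count
    ... | zero = inj₁ refl
    ... | suc _ = inj₂ refl

    parent-of-new : parentOf' (pred count) ≡ 0
    parent-of-new = update-same _≟_ parentOf (pred count) 0

    module T = Tree parentOf' parentOf'≤

    interval-z : ∀ a b → BelowN parentOf' a count → a ≤ b → b ≤ count → BelowN parentOf' a b
    interval-z a b a≼count a≤b b≤count with count-cases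
    ... | inj₁ count≡0 = subst (BelowN parentOf' a) (trans a≡0 (sym b≡0)) here
      where
        b≡0 : b ≡ 0
        b≡0 = n≤0⇒n≡0 (subst (b ≤_) count≡0 b≤count)
        a≡0 : a ≡ 0
        a≡0 = n≤0⇒n≡0 (subst (a ≤_) b≡0 a≤b)
    ... | inj₂ suc-pred-count with T.≼suc-inv (subst (BelowN parentOf' a) (sym suc-pred-count) a≼count)
    ... | inj₁ a≡ = at-count (trans a≡ suc-pred-count)
      where
        at-count : a ≡ count → BelowN parentOf' a b
        at-count refl = subst (BelowN parentOf' count) (≤-antisym a≤b b≤count) here
    ... | inj₂ a≼0 =
      subst (λ u → BelowN parentOf' u b) (sym (T.≼0⇒≡0 (subst (BelowN parentOf' a) parent-of-new a≼0))) (T.0≼ b)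

    open Preserved arc-to-z interval-z (here refl) (λ g g∈ → ⊥-elim (∉[] (subst (_ ∈_) stack≡[] g∈)))

    treeArc' : ∀ b → suc b < suc count → TreeArc s' b
    treeArc' b sb<sc with m<1+n⇒m<n∨m≡n sb<sc
    ... | inj₁ sb<count = treeArc-old b sb<count
    ... | inj₂ refl = inj₂ (parent-of-new , closed)
      where
        closed : PrefixClosed s' b
        closed y w arc y-visited' iy≤b with visited'-cases y y-visited'
        ... | inj₁ refl = ⊥-elim (<-irrefl refl (subst (_≤ b) index'-z iy≤b))
        ... | inj₂ y-visited = visited'-old w w-visited ,
              subst (_≤ b) (sym (index'-old w w-visited)) (≤-pred (index< w w-visited))
          where w-visited = all-finished y y-visited w arc

    stackPath' : StackPath parentOf' (suc count) (count ∷ [])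
    stackPath' = bottom count ≤-refl depth≤1
      where
        depth≤1 : Depth≤1 parentOf' count
        depth≤1 with count-cases
        ... | inj₁ count≡0 = inj₁ count≡0
        ... | inj₂ suc-pred-count = inj₂ (pred count , sym suc-pred-count , parent-of-new)

    stack-below' : ∀ h → h ∈ (count ∷ []) → ∀ i → h ≤ i → i < suc count → BelowN parentOf' h i
    stack-below' h (here refl) i h≤i i<sc = subst (BelowN parentOf' h) (≤-antisym h≤i (≤-pred i<sc)) here

    invariant : Invariant s'
    invariant = record
      { parentOf≤ = parentOf'≤ ; index< = index<' ; vertexAt-index = vertexAt-index'
      ; visited-vertexAt = visited-vertexAt' ; index-vertexAt = index-vertexAt' ; treeArc = treeArc'
      ; forward-below = forward-below' ; subtree-interval = subtree-interval'
      ; finished-closed = finished-closed' ; stackPath = stackPath' ; stack-below = stack-below' }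

  pop : State → List ℕ → State
  pop s rest = record s { stack = rest }

  module Pop (s : State) (I : Invariant s) (g : ℕ) (rest : List ℕ) (stack≡ : State.stack s ≡ g ∷ rest)
             (g-done : ∀ w → Arc D (State.vertexAt s g) w → State.visited s w ≡ true) where
    open State s
    open Invariant I

    finished-closed' : ∀ y → visited y ≡ true → index y ∉ rest → ∀ w → Arc D y w → visited w ≡ true
    finished-closed' y y-visited iy∉ w arc with index y ≟ g
    ... | yes iy≡g =
      g-done w (subst (λ u → Arc D u w) (trans (sym (vertexAt-index y y-visited)) (cong vertexAt iy≡g)) arc)
    ... | no iy≢g = finished-closed y y-visited (λ iy∈ → not-on-stack (subst (_ ∈_) stack≡ iy∈)) w arc
      where
        not-on-stack : index y ∉ (g ∷ rest)
        not-on-stack (here iy≡g) = iy≢g iy≡g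
        not-on-stack (there iy∈) = iy∉ iy∈

    invariant : Invariant (pop s rest)
    invariant = record
      { parentOf≤ = parentOf≤ ; index< = index< ; vertexAt-index = vertexAt-index
      ; visited-vertexAt = visited-vertexAt ; index-vertexAt = index-vertexAt ; treeArc = treeArc
      ; forward-below = forward-below ; subtree-interval = subtree-interval
      ; finished-closed = finished-closed'
      ; stackPath = StackPath-pop (subst (StackPath parentOf count) stack≡ stackPath)
      ; stack-below = λ h h∈ → stack-below h (subst (_ ∈_) (sym stack≡) (there h∈)) }

  N : ℕ
  N = suc (size D)

  -- Pigeonhole on z and vertexAt 0, …, vertexAt (N - 1).
  count<N : ∀ s → Invariant s → ∀ z → State.visited s z ≡ false → State.count s < N
  count<N s I z z-new with State.count s <? N
  ... | yes count<N = count<N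
  ... | no count≮N = ⊥-elim (no-collision (FinP.pigeonhole (n<1+n N) label))
    where
      open State s
      open Invariant I
      in-use : ∀ (i : Fin N) → toℕ i < count
      in-use i = <-≤-trans (FinP.toℕ<n i) (≮⇒≥ count≮N)
      label : Fin (suc N) → V D
      label zero = z
      label (suc i) = vertexAt (toℕ i)
      no-collision : ¬ (∃ λ i → ∃ λ j → toℕ i < toℕ j × label i ≡ label j)
      no-collision (zero , suc j , _ , z≡)
        with trans (sym (trans (cong visited z≡) (visited-vertexAt (toℕ j) (in-use j)))) z-new
      ... | ()
      no-collision (suc i , suc j , i<j , same) = <-irrefl (begin
        toℕ i                          ≡⟨ sym (index-vertexAt (toℕ i) (in-use i)) ⟩
        index (vertexAt (toℕ i))       ≡⟨ cong index same ⟩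
        index (vertexAt (toℕ j))       ≡⟨ index-vertexAt (toℕ j) (in-use j) ⟩
        toℕ j                          ∎) (≤-pred i<j)
        where open ≡-Reasoning

  -- A push uses up an unvisited vertex (−2) and grows the stack (+1); a pop shrinks the stack.
  measure : State → ℕ
  measure s = (N ∸ State.count s) + (N ∸ State.count s) + length (State.stack s)

  +-double-< : ∀ m n L → m < n → m + m + suc L < n + n + L
  +-double-< m n L m<n = begin-strict
    m + m + suc L          ≡⟨ +-suc (m + m) L ⟩
    suc (m + m + L)        <⟨ n<1+n _ ⟩
    suc (suc (m + m + L))  ≡⟨ cong (λ k → suc k + L) (sym (+-suc m m)) ⟩
    suc m + suc m + L      ≤⟨ +-monoˡ-≤ L (+-mono-≤ m<n m<n) ⟩
    n + n + L              ∎
    where open ≤-Reasoning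

  measure-extend : ∀ s z x stack' → State.count s < N → length stack' ≡ suc (length (State.stack s)) →
                   measure (extend s z x stack') < measure s
  measure-extend s z x stack' count<N length≡ =
    subst (λ L → left + left + L < measure s) (sym length≡)
      (+-double-< left (N ∸ count) (length stack) (∸-monoʳ-< (n<1+n count) count<N))
    where
      open State s
      left = N ∸ suc count

  measure-pop : ∀ s g rest → State.stack s ≡ g ∷ rest → measure (pop s rest) < measure s
  measure-pop s g rest stack≡ =
    subst (λ st → measure (pop s rest) < unvisited + unvisited + length st) (sym stack≡)
      (≤-reflexive (sym (+-suc (unvisited + unvisited) (length rest))))
    where unvisited = N ∸ State.count s

  Complete : Set
  Complete = Σ State λ s → Invariant s × (∀ z → State.visited s z ≡ true)

  search : (fuel : ℕ) (s : State) → Invariant s → measure s < fuel → Complete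
  search (suc fuel) s I μ<sfuel = continue (State.stack s) refl
    where
      open State s
      μ≤fuel = ≤-pred μ<sfuel

      continue : ∀ st → stack ≡ st → Complete
      continue [] stack≡ with FinP.any? (λ z → visited z Bool.≟ false)
      ... | yes (z , z-new) =
            search fuel (extend s z 0 (count ∷ [])) (Restart.invariant s I stack≡ z z-new)
              (<-≤-trans (measure-extend s z 0 (count ∷ []) (count<N s I z z-new)
                                         (cong (λ st → suc (length st)) (sym stack≡)))
                         μ≤fuel)
      ... | no none-new = s , I , λ z → ¬-not (λ z-new → none-new (z , z-new))
      continue (g ∷ rest) stack≡
        with FinP.any? (λ z → (arc D (vertexAt g) z Bool.≟ true) ×-dec (visited z Bool.≟ false))
      ... | yes (z , g→z , z-new) =
            search fuel (extend s z g (count ∷ stack)) (Push.invariant s I g rest stack≡ z z-new g→z)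
              (<-≤-trans (measure-extend s z g (count ∷ stack) (count<N s I z z-new) refl) μ≤fuel)
      ... | no no-new-out =
            search fuel (pop s rest) (Pop.invariant s I g rest stack≡ g-done)
              (<-≤-trans (measure-pop s g rest stack≡) μ≤fuel)
        where
          g-done : ∀ w → Arc D (vertexAt g) w → visited w ≡ true
          g-done w g→w = ¬-not (λ w-new → no-new-out (w , g→w , w-new))

  initial : State
  initial = mkState 0 (λ _ → zero) (λ _ → 0) (λ _ → false) (λ _ → 0) []

  initial-invariant : Invariant initial
  initial-invariant = record
    { parentOf≤ = λ _ → z≤n ; index< = λ _ () ; vertexAt-index = λ _ () ; visited-vertexAt = λ _ ()
    ; index-vertexAt = λ _ () ; treeArc = λ _ () ; forward-below = λ _ _ _ () ; subtree-interval = λ _ _ _ _ _ _ ()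
    ; finished-closed = λ _ () ; stackPath = empty ; stack-below = λ _ () }

  complete : Complete
  complete = search (suc (measure initial)) initial initial-invariant ≤-refl

unique-∷ : ∀ {A : Set} {x : A} {xs} → x ∉ xs → Unique xs → Unique (x ∷ xs)
unique-∷ {xs = xs} x∉xs xs! = ¬Any⇒All¬ xs x∉xs ∷ xs!

module Walks (D : Digraph) where

  Walk : V D → V D → Set
  Walk = Star (Arc D)

  vertices : ∀ {x y} → Walk x y → List (V D)
  vertices {x} ε = x ∷ []
  vertices {x} (_ ◅ w) = x ∷ vertices w

  steps : ∀ {x y} → Walk x y → ℕ
  steps ε = 0
  steps (_ ◅ w) = suc (steps w)

  start∈ : ∀ {x y} (w : Walk x y) → x ∈ vertices w
  start∈ ε = here refl
  start∈ (_ ◅ w) = here refl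

  end∈ : ∀ {x y} (w : Walk x y) → y ∈ vertices w
  end∈ ε = here refl
  end∈ (_ ◅ w) = there (end∈ w)

  ∈-◅◅⁻ : ∀ {x y z u} (q : Walk x y) (t : Walk y z) → u ∈ vertices (q ◅◅ t) →
          u ∈ vertices q ⊎ u ∈ vertices t
  ∈-◅◅⁻ ε t u∈ = inj₂ u∈
  ∈-◅◅⁻ (_ ◅ q) t (here u≡x) = inj₁ (here u≡x)
  ∈-◅◅⁻ (_ ◅ q) t (there u∈) with ∈-◅◅⁻ q t u∈
  ... | inj₁ u∈q = inj₁ (there u∈q)
  ... | inj₂ u∈t = inj₂ u∈t

  steps-◅◅ : ∀ {x y z} (q : Walk x y) (t : Walk y z) → steps (q ◅◅ t) ≡ steps q + steps t
  steps-◅◅ ε t = refl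
  steps-◅◅ (_ ◅ q) t = cong suc (steps-◅◅ q t)

  unique-◅◅ : ∀ {x y z} (q : Walk x y) (t : Walk y z) → Unique (vertices q) → Unique (vertices t) →
              (∀ u → u ∈ vertices q → u ∈ vertices t → u ≡ y) → Unique (vertices (q ◅◅ t))
  unique-◅◅ ε t _ t! _ = t!
  unique-◅◅ {x} (_ ◅ q) t q! t! only-y =
    unique-∷ x∉ (unique-◅◅ q t (tail q!) t! λ u u∈q → only-y u (there u∈q))
    where
      tail : ∀ {v vs} → Unique (v ∷ vs) → Unique vs
      tail (_ ∷ vs!) = vs!
      x∉ : x ∉ vertices (q ◅◅ t)
      x∉ x∈ with ∈-◅◅⁻ q t x∈
      ... | inj₁ x∈q = Unique[x∷xs]⇒x∉xs q! x∈q
      ... | inj₂ x∈t =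
        Unique[x∷xs]⇒x∉xs q! (subst (_∈ vertices q) (sym (only-y x (here refl) x∈t)) (end∈ q))

  infixl 5 _▸_
  _▸_ : ∀ {x y z} → Walk x y → Arc D y z → Walk x z
  w ▸ a = w ◅◅ a ◅ ε

  ∈-▸⁻ : ∀ {x y z u} (w : Walk x y) (a : Arc D y z) → u ∈ vertices (w ▸ a) → u ∈ vertices w ⊎ u ≡ z
  ∈-▸⁻ w a u∈ with ∈-◅◅⁻ w (a ◅ ε) u∈
  ... | inj₁ u∈w = inj₁ u∈w
  ... | inj₂ (here refl) = inj₁ (end∈ w)
  ... | inj₂ (there (here u≡z)) = inj₂ u≡z

  unique-▸ : ∀ {x y z} (w : Walk x y) (a : Arc D y z) → Unique (vertices w) → z ∉ vertices w →
             Unique (vertices (w ▸ a))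
  unique-▸ {y = y} {z} w a w! z∉w = unique-◅◅ w (a ◅ ε) w! (unique-∷ y∉[z] (unique-∷ (λ ()) [])) only-y
    where
      y∉[z] : y ∉ z ∷ []
      y∉[z] (here y≡z) = z∉w (subst (_∈ vertices w) y≡z (end∈ w))
      only-y : ∀ u → u ∈ vertices w → u ∈ y ∷ z ∷ [] → u ≡ y
      only-y u _ (here u≡y) = u≡y
      only-y u u∈w (there (here u≡z)) = ⊥-elim (z∉w (subst (_∈ vertices w) u≡z u∈w))

  steps-▸ : ∀ {x y z} (w : Walk x y) (a : Arc D y z) → steps (w ▸ a) ≡ suc (steps w)
  steps-▸ w a = trans (steps-◅◅ w (a ◅ ε)) (+-comm (steps w) 1)

  suffix : ∀ {x y z} (w : Walk y z) → x ∈ vertices w →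
           Σ (Walk x z) λ q → vertices q ⊆ vertices w × (Unique (vertices w) → Unique (vertices q))
  suffix ε (here refl) = ε , id , id
  suffix w@(_ ◅ _) (here refl) = w , id , id
  suffix (_ ◅ w) (there x∈) with suffix w x∈
  ... | q , q⊆w , unique = q , there ∘ q⊆w , λ { (_ ∷ w!) → unique w! }

  vertex : ∀ {x y} (w : Walk x y) → Fin (suc (steps w)) → V D
  vertex {x} ε _ = x
  vertex {x} (_ ◅ w) zero = x
  vertex (_ ◅ w) (suc i) = vertex w i

  vertex-first : ∀ {x y} (w : Walk x y) → vertex w zero ≡ x
  vertex-first ε = refl
  vertex-first (_ ◅ w) = refl

  vertex-last : ∀ {x y} (w : Walk x y) → vertex w (fromℕ (steps w)) ≡ y
  vertex-last ε = refl
  vertex-last (_ ◅ w) = vertex-last w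

  vertex-step : ∀ {x y} (w : Walk x y) (i : Fin (steps w)) → Arc D (vertex w (inject₁ i)) (vertex w (suc i))
  vertex-step (a ◅ w) zero = subst (Arc D _) (sym (vertex-first w)) a
  vertex-step (_ ◅ w) (suc i) = vertex-step w i

  vertex∈ : ∀ {x y} (w : Walk x y) i → vertex w i ∈ vertices w
  vertex∈ ε _ = here refl
  vertex∈ (_ ◅ w) zero = here refl
  vertex∈ (_ ◅ w) (suc i) = there (vertex∈ w i)

  vertex-injective : ∀ {x y} (w : Walk x y) → Unique (vertices w) →
                     ∀ i j → vertex w i ≡ vertex w j → i ≡ j
  vertex-injective ε _ zero zero _ = refl
  vertex-injective (_ ◅ w) _ zero zero _ = refl
  vertex-injective (_ ◅ w) w! zero (suc j) x≡ =
    ⊥-elim (Unique[x∷xs]⇒x∉xs w! (subst (_∈ vertices w) (sym x≡) (vertex∈ w j)))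
  vertex-injective (_ ◅ w) w! (suc i) zero ≡x =
    ⊥-elim (Unique[x∷xs]⇒x∉xs w! (subst (_∈ vertices w) ≡x (vertex∈ w i)))
  vertex-injective (_ ◅ w) (_ ∷ w!) (suc i) (suc j) same = cong suc (vertex-injective w w! i j same)

  cycle : ∀ {x y} (w : Walk x y) → Unique (vertices w) → Arc D y x → DirectedCycle D (steps w)
  cycle w w! y→x = record
    { vtx = vertex w
    ; distinct = vertex-injective w w! _ _
    ; step = vertex-step w
    ; close = subst₂ (Arc D) (sym (vertex-last w)) (sym (vertex-first w)) y→x }

  walk : ∀ {k} (w : DirectedWalk D k) → Walk (DirectedWalk.vtx w zero) (DirectedWalk.vtx w (fromℕ k))
  walk {zero} w = ε
  walk {suc k} w = step zero ◅ walk (record { vtx = vtx ∘ suc ; step = step ∘ suc })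
    where open DirectedWalk w

  vertices-walk : ∀ {k} (w : DirectedWalk D k) → vertices (walk w) ≡ List.tabulate (DirectedWalk.vtx w)
  vertices-walk {zero} w = refl
  vertices-walk {suc k} w = cong (vtx zero ∷_) (vertices-walk (record { vtx = vtx ∘ suc ; step = step ∘ suc }))
    where open DirectedWalk w

module CompleteSearch (D : Digraph) (s : DFS.State D) (I : DFS.Invariant D s)
              (all-visited : ∀ z → DFS.State.visited s z ≡ true) where
  open DFS.State s
  open DFS.Invariant I
  open Walks D
  open Tree parentOf parentOf≤
  open import Data.List.Membership.DecPropositional (FinP._≟_ {suc (size D)}) using () renaming (_∈?_ to _∈V?_)

  index<count : ∀ y → index y < count
  index<count y = index< y (all-visited y)

  vertexAt∘index : ∀ y → vertexAt (index y) ≡ y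
  vertexAt∘index y = vertexAt-index y (all-visited y)

  index-injective : ∀ {u v} → index u ≡ index v → u ≡ v
  index-injective {u} {v} same = trans (sym (vertexAt∘index u)) (trans (cong vertexAt same) (vertexAt∘index v))

  forward-arc⇒≼ : ∀ y z → Arc D y z → index y < index z → index y ≼ index z
  forward-arc⇒≼ y z y→z iy<iz = forward-below y z y→z (all-visited y) (all-visited z) iy<iz

  RestartAt : ℕ → Set
  RestartAt b = parentOf b ≡ 0 × (∀ y z → Arc D y z → index y ≤ b → index z ≤ b)

  tree-arc : ∀ b → suc b < count → Arc D (vertexAt (parentOf b)) (vertexAt (suc b)) ⊎ RestartAt b
  tree-arc b sb<count with treeArc b sb<count
  ... | inj₁ arc = inj₁ arc
  ... | inj₂ (pb≡0 , closed) =
    inj₂ (pb≡0 , λ y z y→z iy≤b → proj₂ (closed y z y→z (all-visited y) iy≤b))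

  walk-stays-before-restart : ∀ {x e} b → RestartAt b → (w : Walk x e) → index x ≤ b → index e ≤ b
  walk-stays-before-restart b restart ε ix≤b = ix≤b
  walk-stays-before-restart b restart (x→y ◅ w) ix≤b =
    walk-stays-before-restart b restart w (proj₂ restart _ _ x→y ix≤b)

  tree-path : ∀ {u v} (iu≼iv : index u ≼ index v) →
    (Σ (Walk u v) λ w →
       (∀ t → t ∈ vertices w → index t ≼ index v) × Unique (vertices w) × steps w ≡ distance iu≼iv)
    ⊎ (Σ ℕ λ b → RestartAt b × suc b ≼ index v × index u ≤ b)
  tree-path {u} {v} iu≼iv = go iu≼iv v refl
    where
      go : ∀ {c} (iu≼c : index u ≼ c) v → index v ≡ c →
        (Σ (Walk u v) λ w →
           (∀ t → t ∈ vertices w → index t ≼ c) × Unique (vertices w) × steps w ≡ distance iu≼c)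
        ⊎ (Σ ℕ λ b → RestartAt b × suc b ≼ c × index u ≤ b)
      go here v iv≡ with index-injective {u} {v} (sym iv≡)
      ... | refl = inj₁ (ε , (λ { t (here refl) → here }) , unique-∷ (λ ()) [] , refl)
      go (child b iu≼pb) v iv≡ with go iu≼pb (vertexAt (parentOf b)) (index-vertexAt (parentOf b) pb<count)
        where pb<count = ≤-<-trans (parentOf≤ b) (<-trans (n<1+n b) (subst (_< count) iv≡ (index<count v)))
      ... | inj₂ (b' , restart , sb'≼pb , iu≤b') = inj₂ (b' , restart , child b sb'≼pb , iu≤b')
      ... | inj₁ (w , w-below , w! , steps≡) with tree-arc b (subst (_< count) iv≡ (index<count v))
      ...   | inj₂ restart = inj₂ (b , restart , here , ≤-trans (≼⇒≤ iu≼pb) (parentOf≤ b))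
      ...   | inj₁ arc =
        inj₁ (w ▸ arc′ , below , unique-▸ w arc′ w! v∉w , trans (steps-▸ w arc′) (cong suc steps≡))
        where
          arc′ : Arc D (vertexAt (parentOf b)) v
          arc′ = subst (Arc D _) (trans (cong vertexAt (sym iv≡)) (vertexAt∘index v)) arc
          below : ∀ t → t ∈ vertices (w ▸ arc′) → index t ≼ suc b
          below t t∈ with ∈-▸⁻ w arc′ t∈
          ... | inj₁ t∈w = child b (w-below t t∈w)
          ... | inj₂ refl = subst (BelowN parentOf (index t)) iv≡ here
          v∉w : v ∉ vertices w
          v∉w v∈w =
            <⇒≱ (s≤s ≤-refl) (≤-trans (subst (_≤ parentOf b) iv≡ (≼⇒≤ (w-below v v∈w))) (parentOf≤ b))

  module Regions (c : ℕ) where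

    InSubtree ProperAncestor Left Right : V D → Set
    InSubtree u = c ≼ index u
    ProperAncestor u = index u ≼ c × index u < c
    Left u = index u < c × ¬ index u ≼ c
    Right u = c ≤ index u × ¬ InSubtree u

    region : ∀ u → InSubtree u ⊎ ProperAncestor u ⊎ Left u ⊎ Right u
    region u with c ≼? index u
    ... | yes in-subtree = inj₁ in-subtree
    ... | no not-in-subtree with index u <? c
    ...   | no iu≮c = inj₂ (inj₂ (inj₂ (≮⇒≥ iu≮c , not-in-subtree)))
    ...   | yes iu<c with index u ≼? c
    ...     | yes iu≼c = inj₂ (inj₁ (iu≼c , iu<c))
    ...     | no iu⋠c = inj₂ (inj₂ (inj₁ (iu<c , iu⋠c)))

    no-arc-subtree→right : ∀ y w → InSubtree y → Arc D y w → ¬ Right w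
    no-arc-subtree→right y w c≼iy y→w (c≤iw , not-in-subtree) with index y <? index w
    ... | yes iy<iw = not-in-subtree (≼-trans c≼iy (forward-arc⇒≼ y w y→w iy<iw))
    ... | no iy≮iw =
      not-in-subtree (subtree-interval c (index w) (index y) c≼iy c≤iw (≮⇒≥ iy≮iw) (index<count y))

    no-arc-left→subtree : ∀ y w → Left y → Arc D y w → ¬ InSubtree w
    no-arc-left→subtree y w (iy<c , iy⋠c) y→w c≼iw
      with ≼-comparable (forward-arc⇒≼ y w y→w (<-≤-trans iy<c (≼⇒≤ c≼iw))) c≼iw
    ... | inj₁ iy≼c = iy⋠c iy≼c
    ... | inj₂ c≼iy = <⇒≱ iy<c (≼⇒≤ c≼iy)

    no-arc-left→right : ∀ y w → Left y → Arc D y w → ¬ Right w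
    no-arc-left→right y w (iy<c , iy⋠c) y→w (c≤iw , _) =
      iy⋠c (subtree-interval (index y) c (index w) (forward-arc⇒≼ y w y→w (<-≤-trans iy<c c≤iw))
                             (<⇒≤ iy<c) c≤iw (index<count w))

  -- ancestor stops at the root, so 0 repeats when c has fewer than l proper ancestors.
  NearAncestor : ℕ → ℕ → ℕ → Set
  NearAncestor l c a = Σ (Fin l) λ j → ancestor (suc (toℕ j)) c ≡ a

  module Guarding (l : ℕ) (circ : CircumferenceAtMost D l) (c : ℕ) (1≤c : 1 ≤ c) where
    open Regions c

    Unguarded : V D → Set
    Unguarded u = ¬ NearAncestor l c (index u)

    far-ancestor : ∀ a → Unguarded a → (ia≼c : index a ≼ c) → index a < c → l < distance ia≼c
    far-ancestor a unguarded ia≼c ia<c with distance ia≼c | ancestor-distance ia≼c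
    ... | zero | ia≡c = ⊥-elim (<-irrefl (sym ia≡c) ia<c)
    ... | suc j | ancestor≡ with j <? l
    ...   | yes j<l =
      ⊥-elim (unguarded (fromℕ< j<l , trans (cong (λ t → ancestor (suc t) c) (FinP.toℕ-fromℕ< j<l)) ancestor≡))
    ...   | no j≮l = s≤s (≮⇒≥ j≮l)

    -- From a left vertex, a walk into the subtree must first climb to an (unguarded) proper ancestor.
    record Climb (x e : V D) : Set where
      constructor mkClimb
      field
        top           : V D
        top-ancestor  : ProperAncestor top
        top-unguarded : Unguarded top
        path          : Walk x top
        path-left     : ∀ u → u ∈ vertices path → Left u ⊎ u ≡ top
        path-unique   : Unique (vertices path)
        rest          : Walk top e

    arrived : ∀ {y e} → ProperAncestor y → Unguarded y → Walk y e → Climb y e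
    arrived ancestor-y unguarded-y w =
      mkClimb _ ancestor-y unguarded-y ε (λ { u (here refl) → inj₂ refl }) (unique-∷ (λ ()) []) w

    climb-back : ∀ {x y e} → Left x → Arc D x y → Climb y e → Climb x e
    climb-back {x} left-x x→y (mkClimb top ancestor unguarded path path-left path! rest)
      with x ∈V? vertices path
    ... | no x∉ =
          mkClimb top ancestor unguarded (x→y ◅ path)
            (λ { u (here refl) → inj₁ left-x ; u (there u∈) → path-left u u∈ }) (unique-∷ x∉ path!) rest
    ... | yes x∈ with suffix path x∈
    ...   | path′ , path′⊆ , path′! =
            mkClimb top ancestor unguarded path′ (λ u u∈ → path-left u (path′⊆ u∈)) (path′! path!) rest

    climb : ∀ {x e} (w : Walk x e) → Left x → InSubtree e → All Unguarded (vertices w) → Climb x e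
    climb ε (ix<c , _) c≼ie _ = ⊥-elim (<⇒≱ ix<c (≼⇒≤ c≼ie))
    climb {x} (_◅_ {j = y} x→y w) left-x in-e (_ ∷ unguarded) with region y
    ... | inj₁ in-y = ⊥-elim (no-arc-left→subtree x y left-x x→y in-y)
    ... | inj₂ (inj₂ (inj₂ right-y)) = ⊥-elim (no-arc-left→right x y left-x x→y right-y)
    ... | inj₂ (inj₁ ancestor-y) = climb-back left-x x→y (arrived ancestor-y (All.lookup unguarded (start∈ w)) w)
    ... | inj₂ (inj₂ (inj₁ left-y)) = climb-back left-x x→y (climb w left-y in-e unguarded)

    record Departure (e : V D) : Set where
      constructor mkDeparture
      field
        from        : V D
        from-inside : InSubtree from
        to          : V D
        exit        : Arc D from to
        climbing    : Climb to e

    depart : ∀ {x e} (w : Walk x e) → InSubtree x → InSubtree e → All Unguarded (vertices w) →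
             Any (¬_ ∘ InSubtree) (vertices w) → Departure e
    depart ε in-x _ _ (here out-x) = ⊥-elim (out-x in-x)
    depart (_ ◅ w) in-x _ _ (here out-x) = ⊥-elim (out-x in-x)
    depart {x} (_◅_ {j = y} x→y w) in-x in-e (_ ∷ unguarded) (there leaves) with region y
    ... | inj₁ in-y = depart w in-y in-e unguarded leaves
    ... | inj₂ (inj₂ (inj₂ right-y)) = ⊥-elim (no-arc-subtree→right x y in-x x→y right-y)
    ... | inj₂ (inj₁ ancestor-y) = mkDeparture x in-x y x→y (arrived ancestor-y (All.lookup unguarded (start∈ w)) w)
    ... | inj₂ (inj₂ (inj₁ left-y)) = mkDeparture x in-x y x→y (climb w left-y in-e unguarded)

    restart-before : ∀ {b i} → RestartAt b → suc b ≼ i → c ≼ i → suc b ≤ c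
    restart-before {b} (pb≡0 , _) sb≼i c≼i with ≼-comparable sb≼i c≼i
    ... | inj₁ sb≼c = ≼⇒≤ sb≼c
    ... | inj₂ c≼sb with ≼suc-inv c≼sb
    ...   | inj₁ c≡sb = ≤-reflexive (sym c≡sb)
    ...   | inj₂ c≼pb = ⊥-elim (<⇒≢ 1≤c (sym (≼0⇒≡0 (subst (c ≼_) pb≡0 c≼pb))))

    no-departure : ∀ {e} → InSubtree e → ¬ Departure e
    no-departure in-e
      (mkDeparture from in-from to exit (mkClimb top (itop≼c , itop<c) unguarded path path-left path! rest))
      with tree-path (≼-trans itop≼c in-from)
    ... | inj₂ (b , restart , sb≼from , itop≤b) =
          <⇒≱ (s≤s (walk-stays-before-restart b restart rest itop≤b))
              (≤-trans (restart-before restart sb≼from in-from) (≼⇒≤ in-e))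
    ... | inj₁ (down , down-below , down! , steps≡) =
          <-asym (circ _ (cycle (path ◅◅ down) (unique-◅◅ path down path! down! only-top) exit)) (begin-strict
            l                                             <⟨ far-ancestor top unguarded itop≼c itop<c ⟩
            distance itop≼c                               ≤⟨ m≤n+m _ (distance in-from) ⟩
            distance in-from + distance itop≼c            ≡⟨ sym (trans steps≡ (distance-trans itop≼c in-from)) ⟩
            steps down                                    ≤⟨ m≤n+m _ (steps path) ⟩
            steps path + steps down                       ≡⟨ sym (steps-◅◅ path down) ⟩
            steps (path ◅◅ down)                          ∎)
      where
        open ≤-Reasoning
        only-top : ∀ u → u ∈ vertices path → u ∈ vertices down → u ≡ top
        only-top u u∈path u∈down with path-left u u∈path
        ... | inj₂ u≡top = u≡top
        ... | inj₁ (iu<c , iu⋠c) with ≼-comparable (down-below u u∈down) in-from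
        ...   | inj₁ iu≼c = ⊥-elim (iu⋠c iu≼c)
        ...   | inj₂ c≼iu = ⊥-elim (<⇒≱ iu<c (≼⇒≤ c≼iu))

    no-return : ∀ {x e} (w : Walk x e) → InSubtree x → InSubtree e → All Unguarded (vertices w) →
                ¬ Any (¬_ ∘ InSubtree) (vertices w)
    no-return w in-x in-e unguarded leaves = no-departure in-e (depart w in-x in-e unguarded leaves)

module _ (m : ℕ) (p : ℕ → ℕ) (p≤ : ∀ b → p b ≤ b) where

  parent<suc-m : ∀ (i : Fin m) → p (toℕ i) < suc m
  parent<suc-m i = s≤s (≤-trans (p≤ (toℕ i)) (<⇒≤ (FinP.toℕ<n i)))

  arborescence : OutArborescence
  arborescence = record
    { m = m
    ; par = λ i → fromℕ< (parent<suc-m i)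
    ; par< = λ i → subst (_≤ toℕ i) (sym (FinP.toℕ-fromℕ< (parent<suc-m i))) (p≤ (toℕ i)) }

  Below⇒BelowN : ∀ {a b} → Below arborescence a b → BelowN p (toℕ a) (toℕ b)
  Below⇒BelowN here = here
  Below⇒BelowN {a} (child i a≼pi) =
    child (toℕ i) (subst (BelowN p (toℕ a)) (FinP.toℕ-fromℕ< (parent<suc-m i)) (Below⇒BelowN a≼pi))

  BelowN⇒Below : ∀ {a b} → BelowN p (toℕ a) (toℕ b) → Below arborescence a b
  BelowN⇒Below {a} {b} a≼b = go a≼b b refl
    where
      go : ∀ {n} → BelowN p (toℕ a) n → (b : Fin (suc m)) → toℕ b ≡ n → Below arborescence a b
      go here b b≡a = subst (Below arborescence a) (FinP.toℕ-injective (sym b≡a)) here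
      go (child k a≼pk) (suc i) i≡k =
        child i (go a≼pk (fromℕ< (parent<suc-m i))
                    (trans (FinP.toℕ-fromℕ< (parent<suc-m i)) (cong p (suc-injective i≡k))))

∣p∪q∣≤∣p∣+∣q∣ : ∀ {n} (p q : Subset n) → ∣ p ∪ q ∣ ≤ ∣ p ∣ + ∣ q ∣
∣p∪q∣≤∣p∣+∣q∣ [] [] = z≤n
∣p∪q∣≤∣p∣+∣q∣ (false ∷ p) (false ∷ q) = ∣p∪q∣≤∣p∣+∣q∣ p q
∣p∪q∣≤∣p∣+∣q∣ (false ∷ p) (true ∷ q) =
  subst (suc ∣ p ∪ q ∣ ≤_) (sym (+-suc ∣ p ∣ ∣ q ∣)) (s≤s (∣p∪q∣≤∣p∣+∣q∣ p q))
∣p∪q∣≤∣p∣+∣q∣ (true ∷ p) (false ∷ q) = s≤s (∣p∪q∣≤∣p∣+∣q∣ p q)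
∣p∪q∣≤∣p∣+∣q∣ (true ∷ p) (true ∷ q) =
  s≤s (≤-trans (∣p∪q∣≤∣p∣+∣q∣ p q) (+-monoʳ-≤ ∣ p ∣ (n≤1+n _)))

image : ∀ {n} k → (Fin k → Fin n) → Subset n
image zero g = ⊥ₛ
image (suc k) g = ⁅ g zero ⁆ ∪ image k (g ∘ suc)

∣image∣≤ : ∀ {n} k (g : Fin k → Fin n) → ∣ image k g ∣ ≤ k
∣image∣≤ {n} zero g = ≤-reflexive (∣⊥∣≡0 n)
∣image∣≤ (suc k) g = begin
  ∣ ⁅ g zero ⁆ ∪ image k (g ∘ suc) ∣     ≤⟨ ∣p∪q∣≤∣p∣+∣q∣ ⁅ g zero ⁆ _ ⟩
  ∣ ⁅ g zero ⁆ ∣ + ∣ image k (g ∘ suc) ∣ ≡⟨ cong (_+ ∣ image k (g ∘ suc) ∣) (∣⁅x⁆∣≡1 (g zero)) ⟩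
  suc ∣ image k (g ∘ suc) ∣              ≤⟨ s≤s (∣image∣≤ k (g ∘ suc)) ⟩
  suc k                                  ∎
  where open ≤-Reasoning

∈image : ∀ {n} k (g : Fin k → Fin n) j → g j ∈ₛ image k g
∈image (suc k) g zero = x∈p∪q⁺ (inj₁ (x∈⁅x⁆ (g zero)))
∈image (suc k) g (suc j) = x∈p∪q⁺ (inj₂ (∈image k (g ∘ suc) j))

∣p∣≤-covered : ∀ {n k} (p : Subset n) (g : Fin k → Fin n) →
               (∀ x → x ∈ₛ p → Σ (Fin k) λ j → x ≡ g j) → ∣ p ∣ ≤ k
∣p∣≤-covered {k = k} p g covered = ≤-trans (p⊆q⇒∣p∣≤∣q∣ p⊆image) (∣image∣≤ k g)
  where
    p⊆image : p ⊆ₛ image k g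
    p⊆image {x} x∈p with covered x x∈p
    ... | j , refl = ∈image k g j

module _ {n : ℕ} {P : Fin n → Set} (P? : ∀ x → Dec (P x)) where

  ∈-decide⁻ : ∀ x → x ∈ₛ tabulate (λ y → does (P? y)) → P x
  ∈-decide⁻ x x∈ with P? x | trans (sym (lookup∘tabulate (λ y → does (P? y)) x)) ([]=⇒lookup x∈)
  ... | yes px | _ = px
  ... | no _ | ()

  ∈-decide⁺ : ∀ x → P x → x ∈ₛ tabulate (λ y → does (P? y))
  ∈-decide⁺ x px = lookup⇒[]= x _ (trans (lookup∘tabulate (λ y → does (P? y)) x) (dec-true (P? x) px))

∈⋃-map⁻ : ∀ {A : Set} {n} (f : A → Subset n) (as : List A) x →
          x ∈ₛ ⋃ (List.map f as) → Σ A λ a → a ∈ as × x ∈ₛ f a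
∈⋃-map⁻ f [] x x∈ = ⊥-elim (∉⊥ x∈)
∈⋃-map⁻ f (a ∷ as) x x∈ with x∈p∪q⁻ (f a) (⋃ (List.map f as)) x∈
... | inj₁ x∈fa = a , here refl , x∈fa
... | inj₂ x∈rest with ∈⋃-map⁻ f as x x∈rest
...   | a′ , a′∈ , x∈fa′ = a′ , there a′∈ , x∈fa′

WidthAtMost-mono : ∀ {D} (d : ArborealDecomposition D) {k k′} → k ≤ k′ → WidthAtMost d k → WidthAtMost d k′
WidthAtMost-mono d k≤k′ width r = ≤-trans (width r) (s≤s k≤k′)

module Decomposition (D : Digraph) (l : ℕ) (circ : CircumferenceAtMost D l) (s : DFS.State D)
                     (I : DFS.Invariant D s) (all-visited : ∀ z → DFS.State.visited s z ≡ true) where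
  open DFS.State s
  open DFS.Invariant I
  open CompleteSearch D s I all-visited
  open Tree parentOf parentOf≤
  open Walks D

  suc-pred-count : suc (pred count) ≡ count
  suc-pred-count = suc-pred count {{>-nonZero (≤-<-trans z≤n (index<count zero))}}

  R : OutArborescence
  R = arborescence (pred count) parentOf parentOf≤

  index<suc-m : ∀ v → index v < suc (pred count)
  index<suc-m v = subst (index v <_) (sym suc-pred-count) (index<count v)

  node : V D → Node R
  node v = fromℕ< (index<suc-m v)

  toℕ-node : ∀ v → toℕ (node v) ≡ index v
  toℕ-node v = FinP.toℕ-fromℕ< (index<suc-m v)

  near? : ∀ c a → Dec (NearAncestor l c a)
  near? c a = FinP.any? (λ j → ancestor (suc (toℕ j)) c ≟ a)

  guard : ArcR R → Subset (suc (size D))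
  guard i = tabulate (λ v → does (near? (suc (toℕ i)) (index v)))

  Below⇒≼ : ∀ i v → Below R (suc i) (node v) → suc (toℕ i) ≼ index v
  Below⇒≼ i v below =
    subst (suc (toℕ i) ≼_) (toℕ-node v) (Below⇒BelowN (pred count) parentOf parentOf≤ below)

  ≼⇒Below : ∀ i v → suc (toℕ i) ≼ index v → Below R (suc i) (node v)
  ≼⇒Below i v c≼iv =
    BelowN⇒Below (pred count) parentOf parentOf≤ (subst (suc (toℕ i) ≼_) (sym (toℕ-node v)) c≼iv)

  guarded : ∀ i → Guarded D (guard i) (λ v → Below R (suc i) (node v))
  guarded i = guard-outside , no-walk-returns
    where
      c = suc (toℕ i)
      open CompleteSearch.Guarding D s I all-visited l circ c (s≤s z≤n)

      guard-outside : ∀ v → Below R (suc i) (node v) → v ∉ₛ guard i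
      guard-outside v below v∈ with ∈-decide⁻ (λ v → near? c (index v)) v v∈
      ... | j , ancestor≡ =
        <⇒≱ (subst (_< c) ancestor≡ (proper-ancestor-< (toℕ j) (toℕ i))) (≼⇒≤ (Below⇒≼ i v below))

      no-walk-returns : ∀ k (w : DirectedWalk D k) → let open DirectedWalk w in
        (∀ j → vtx j ∉ₛ guard i) →
        Below R (suc i) (node (vtx zero)) → Below R (suc i) (node (vtx (fromℕ k))) →
        ¬ (Σ (Fin (suc k)) λ j → ¬ Below R (suc i) (node (vtx j)) × vtx j ∉ₛ guard i)
      no-walk-returns k w avoids first-in last-in (j , j-out , _) =
        no-return (walk w) (Below⇒≼ i _ first-in) (Below⇒≼ i _ last-in)
          (subst (All Unguarded) (sym (vertices-walk w))
            (Allₚ.tabulate⁺ {f = vtx} (λ j near → avoids j (∈-decide⁺ (λ v → near? c (index v)) (vtx j) near))))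
          (subst (Any (¬_ ∘ Regions.InSubtree c)) (sym (vertices-walk w))
            (Anyₚ.tabulate⁺ {f = vtx} j (λ in-subtree → j-out (≼⇒Below i (vtx j) in-subtree))))
        where open DirectedWalk w

  nonempty : ∀ (r : Node R) → ∃ λ v → node v ≡ r
  nonempty r =
    vertexAt (toℕ r) , FinP.toℕ-injective (trans (toℕ-node (vertexAt (toℕ r))) (index-vertexAt (toℕ r) r<count))
    where
      r<count : toℕ r < count
      r<count = subst (toℕ r <_) suc-pred-count (FinP.toℕ<n r)

  decomposition : ArborealDecomposition D
  decomposition = record { R = R ; X = guard ; bagOf = node ; nonempty = nonempty ; guarded = guarded }

  incident⁻ : ∀ r i → incident R r i ≡ true → headR R i ≡ r ⊎ tailR R i ≡ r
  incident⁻ r i incident≡ with headR R i FinP.≟ r | tailR R i FinP.≟ r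
  ... | yes head≡ | _ = inj₁ head≡
  ... | no _ | yes tail≡ = inj₂ tail≡
  ... | no _ | no _ with incident≡
  ...   | ()

  arc-at⁻ : ∀ r i → i ∈ List.filter (λ i → incident R r i Bool.≟ true) (List.allFin (m R)) →
            headR R i ≡ r ⊎ tailR R i ≡ r
  arc-at⁻ r i i∈ = incident⁻ r i (proj₂ (∈-filter⁻ (λ i → incident R r i Bool.≟ true) {xs = List.allFin _} i∈))

  toℕ-tailR : ∀ i → toℕ (tailR R i) ≡ parentOf (toℕ i)
  toℕ-tailR i = FinP.toℕ-fromℕ< (parent<suc-m (pred count) parentOf parentOf≤ i)

  -- The guards of the arcs from r to its children add only r itself to r's own guard.
  bag⊆ancestors : ∀ r v → v ∈ₛ ArborealDecomposition.bag decomposition r →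
                  Σ (Fin (suc l)) λ j → index v ≡ ancestor (toℕ j) (toℕ r)
  bag⊆ancestors r v v∈ with x∈p∪q⁻ (ArborealDecomposition.W decomposition r) _ v∈
  ... | inj₁ v∈W =
    zero , trans (sym (toℕ-node v)) (cong toℕ (∈-decide⁻ (λ v → node v FinP.≟ r) v v∈W))
  ... | inj₂ v∈guards with ∈⋃-map⁻ guard _ v v∈guards
  ... | i , i∈ , v∈guard with arc-at⁻ r i i∈ | ∈-decide⁻ (λ v → near? (suc (toℕ i)) (index v)) v v∈guard
  ...   | inj₁ refl | j , ancestor≡ = suc j , sym ancestor≡
  ...   | inj₂ refl | j , ancestor≡ =
          inject₁ j , trans (sym ancestor≡) (cong₂ ancestor (sym (FinP.toℕ-inject₁ j)) (sym (toℕ-tailR i)))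

  width : WidthAtMost decomposition l
  width r = ∣p∣≤-covered (ArborealDecomposition.bag decomposition r) (λ j → vertexAt (ancestor (toℕ j) (toℕ r)))
    λ v v∈ → let (j , index≡) = bag⊆ancestors r v v∈ in
             j , trans (sym (vertexAt∘index v)) (cong vertexAt index≡)

-- The decomposition has width at most l.
mainTheorem3 : (l : ℕ) → 1 ≤ l → (D : Digraph) →
    CircumferenceAtMost D l → DirectedTreeWidthAtMost D (3 * l + 1)
mainTheorem3 l _ D circ with DFS.complete D
... | s , I , all-visited = decomposition , WidthAtMost-mono decomposition l≤3l+1 width
  where
    open Decomposition D l circ s I all-visited
    l≤3l+1 : l ≤ 3 * l + 1
    l≤3l+1 = ≤-trans (m≤m+n l (2 * l)) (m≤m+n (3 * l) 1)
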